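{- Let $M_1=(S_1,r_1)$ and $M_2=(S_2,r_2)$ be matroids, let $B_1$ be a basis of $M_1$ and $B_2$ a basis of $M_2$, and let $S=S_1\times S_2$. Let $N_1$ be the matroid on $S_1\times B_2$ with rank function $X\mapsto\sum_{e_2\in B_2} r_1(\{x\in S_1:(x,e_2)\in X\})$ (the direct sum of copies of $M_1$ indexed by $B_2$), and $N_2$ the matroid on $B_1\times S_2$ with rank function $X\mapsto\sum_{e_1\in B_1} r_2(\{y\in S_2:(e_1,y)\in X\})$. If $M=(S,r)$ is a matroid such that every element of $(S_1\setminus B_1)\times(S_2\setminus B_2)$ is a loop of $M$ and the restriction $M|((S_1\times B_2)\cup(B_1\times S_2))$ is an amalgam of $N_1$ and $N_2$, then $M$ is a coupling of $M_1$ and $M_2$.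
   Context: For matroids $N_1$ on $T_1$ and $N_2$ on $T_2$ whose restrictions to $T_1\cap T_2$ coincide, an amalgam of $N_1$ and $N_2$ is a matroid $N$ on $T_1\cup T_2$ with $N|T_1=N_1$ and $N|T_2=N_2$ ($N|T$ denotes restriction). A loop is an element of rank $0$. A matroid $M=(S_1\times S_2,r)$ is a coupling of $M_1=(S_1,r_1)$ and $M_2=(S_2,r_2)$ if $r(X_1\times S_2)=r_1(X_1)r_2(S_2)$ for all $X_1\subseteq S_1$ and $r(S_1\times X_2)=r_1(S_1)r_2(X_2)$ for all $X_2\subseteq S_2$. -}

module Defs where

open import Data.Nat using (ℕ; zero; suc; _+_; _*_; _≤_)
open import Data.Bool using (Bool; true; false; _∨_; _∧_; not; if_then_else_; T)
open import Data.List using (List; map; allFin; cartesianProduct)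
open import Data.Nat.ListAction using (sum)
open import Data.Fin using (Fin)
open import Data.Product using (_×_; _,_; proj₁; proj₂)
open import Relation.Binary.PropositionalEquality using (_≡_)
open import Relation.Nullary using (¬_)

Subset : Set → Set
Subset E = E → Bool

module _ {E : Set} where
  _⊆_ : Subset E → Subset E → Set
  X ⊆ Y = ∀ e → T (X e) → T (Y e)

  _∪_ : Subset E → Subset E → Subset E
  (X ∪ Y) e = X e ∨ Y e

  _∩_ : Subset E → Subset E → Subset E
  (X ∩ Y) e = X e ∧ Y e

  full : Subset E
  full _ = true

  -- cardinality of X, relative to a duplicate-free list U enumerating E
  card : List E → Subset E → ℕ
  card U X = sum (map (λ e → if X e then 1 else 0) U)

-- A matroid on the finite ground set enumerated by U (the whole type E),
-- given by its rank function with the standard axioms (R1)-(R3).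
record Matroid (E : Set) (U : List E) : Set where
  field
    r      : Subset E → ℕ
    r-card : ∀ X → r X ≤ card U X
    r-mono : ∀ X Y → X ⊆ Y → r X ≤ r Y
    r-sub  : ∀ X Y → r (X ∪ Y) + r (X ∩ Y) ≤ r X + r Y
open Matroid public

FinM : ℕ → Set
FinM n = Matroid (Fin n) (allFin n)

ProdM : ℕ → ℕ → Set
ProdM n₁ n₂ = Matroid (Fin n₁ × Fin n₂) (cartesianProduct (allFin n₁) (allFin n₂))

module _ {E : Set} {U : List E} where
  Independent : Matroid E U → Subset E → Set
  Independent M X = r M X ≡ card U X

  IsBasis : Matroid E U → Subset E → Set
  IsBasis M B = Independent M B ×
    (∀ (X : Subset E) → B ⊆ X → Independent M X → X ⊆ B)

  -- e is a loop: the singleton {e} has rank 0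
  IsLoop : Matroid E U → E → Set
  IsLoop M e = ∀ (X : Subset E) → (∀ f → T (X f) → f ≡ e) → T (X e) → r M X ≡ 0

  -- rank function of the restriction M|T (defined on subsets of T)
  restrict-r : Matroid E U → Subset E → (Subset E → ℕ)
  restrict-r M T X = r M X

module _ {E : Set} where
  IsAmalgam : (Subset E → ℕ) → Subset E → (Subset E → ℕ) → Subset E → (Subset E → ℕ) → Set
  IsAmalgam rN T₁ r₁ T₂ r₂ =
    (∀ X → X ⊆ T₁ → rN X ≡ r₁ X) × (∀ X → X ⊆ T₂ → rN X ≡ r₂ X)


sumOver : {n : ℕ} → Subset (Fin n) → (Fin n → ℕ) → ℕ
sumOver {n} B f = sum (map (λ i → if B i then f i else 0) (allFin n))

module _ {n₁ n₂ : ℕ} where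
  _⊠_ : Subset (Fin n₁) → Subset (Fin n₂) → Subset (Fin n₁ × Fin n₂)
  (X₁ ⊠ X₂) (a , b) = X₁ a ∧ X₂ b

  N₁-rank : FinM n₁ → Subset (Fin n₂) → Subset (Fin n₁ × Fin n₂) → ℕ
  N₁-rank M₁ B₂ X = sumOver B₂ (λ e₂ → r M₁ (λ x → X (x , e₂)))

  N₂-rank : FinM n₂ → Subset (Fin n₁) → Subset (Fin n₁ × Fin n₂) → ℕ
  N₂-rank M₂ B₁ X = sumOver B₁ (λ e₁ → r M₂ (λ y → X (e₁ , y)))

  IsCoupling : ProdM n₁ n₂ → FinM n₁ → FinM n₂ → Set
  IsCoupling M M₁ M₂ =
    (∀ X₁ → r M (X₁ ⊠ full) ≡ r M₁ X₁ * r M₂ full) ×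
    (∀ X₂ → r M (full ⊠ X₂) ≡ r M₁ full * r M₂ X₂)

-- Over a basis element e₁ ∈ B₁ the fibre {e₁} × S₂ carries a copy of M₂ (by the N₂ side of the
-- amalgam), so {e₁} × B₂ spans {e₁} × S₂; the remaining elements off (S₁ × B₂) ∪ (B₁ × S₂) are
-- loops.  Hence X₁ × B₂ spans X₁ × S₂, and the N₁ side gives r(X₁ × B₂) = |B₂| r₁(X₁) = r₁(X₁) r₂(S₂).
-- The equation for S₁ × X₂ is symmetric.
module Submission where

open import Defs
open import Data.Nat using (ℕ; suc; _+_; _*_; _≤_; z≤n; s≤s; s≤s⁻¹)
open import Data.Nat.Properties
  using (≤-trans; ≤-antisym; ≤-reflexive; ≤∧≢⇒<; +-mono-≤; +-monoʳ-≤; +-comm; +-suc;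
         +-identityʳ; +-cancelʳ-≤; m≤m+n; n≤1+n; *-zeroʳ; *-suc; *-comm; module ≤-Reasoning)
  renaming (_≟_ to _≟ℕ_)
open import Data.Bool using (true; false; T; not; _∧_; if_then_else_)
open import Data.Bool.Properties using (T-∧; T-∨; ∧-identityʳ; ∧-zeroʳ; ∨-assoc; ∧-distribˡ-∨)
open import Data.Fin using (Fin)
open import Data.Fin.Properties using (_≟_)
open import Data.Product using (_×_; _,_; proj₁; proj₂)
open import Data.Product.Properties using (≡-dec)
open import Data.Sum using (inj₁; inj₂; [_,_])
open import Data.Empty using (⊥-elim)
open import Data.List using (List; []; _∷_; map; allFin)
open import Data.List.Properties using (map-cong)
open import Data.Nat.ListAction using (sum)
open import Data.List.Relation.Unary.All as All using (All; []; _∷_)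
open import Data.List.Relation.Unary.Any using (here; there)
open import Data.List.Relation.Unary.Unique.Propositional using (Unique; []; _∷_)
open import Data.List.Relation.Unary.Unique.Propositional.Properties using (allFin⁺)
open import Data.List.Membership.Propositional using (_∈_)
open import Data.List.Membership.Propositional.Properties using (∈-allFin; ∈-cartesianProduct⁺)
open import Function using (_∘_; Equivalence)
open import Relation.Binary.Definitions using (DecidableEquality)
open import Relation.Binary.PropositionalEquality using (_≡_; refl; sym; trans; cong; cong₂; subst; module ≡-Reasoning)
open import Relation.Nullary using (¬_; yes; no)
open import Relation.Nullary.Decidable using (⌊_⌋; T?; toWitness; fromWitness)

private
  variable
    E : Set
    X Y Z W : Subset E

open Equivalence

⊆-refl : X ⊆ X
⊆-refl _ t = t

∪-upperˡ : X ⊆ (X ∪ Y)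
∪-upperˡ {X = X} e t = from (T-∨ {X e}) (inj₁ t)

∪-upperʳ : Y ⊆ (X ∪ Y)
∪-upperʳ {X = X} e t = from (T-∨ {X e}) (inj₂ t)

∪-least : X ⊆ Z → Y ⊆ Z → (X ∪ Y) ⊆ Z
∪-least {X = X} X⊆Z Y⊆Z e t = [ X⊆Z e , Y⊆Z e ] (to (T-∨ {X e}) t)

∪-monoʳ : Y ⊆ Z → (X ∪ Y) ⊆ (X ∪ Z)
∪-monoʳ {Z = Z} {X = X} Y⊆Z = ∪-least ∪-upperˡ (λ e t → ∪-upperʳ {Y = Z} {X = X} e (Y⊆Z e t))

∩-lowerˡ : (X ∩ Y) ⊆ X
∩-lowerˡ {X = X} e t = proj₁ (to (T-∧ {X e}) t)

∩-lowerʳ : (X ∩ Y) ⊆ Y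
∩-lowerʳ {X = X} e t = proj₂ (to (T-∧ {X e}) t)

∩-greatest : Z ⊆ X → Z ⊆ Y → Z ⊆ (X ∩ Y)
∩-greatest {X = X} Z⊆X Z⊆Y e t = from (T-∧ {X e}) (Z⊆X e t , Z⊆Y e t)

⊆-full : X ⊆ full
⊆-full _ _ = _

≗⇒⊆ : (∀ e → X e ≡ Y e) → X ⊆ Y
≗⇒⊆ X≗Y e = subst T (X≗Y e)

⊠-mono : ∀ {n₁ n₂} {X₁ Y₁ : Subset (Fin n₁)} {X₂ Y₂ : Subset (Fin n₂)} →
  X₁ ⊆ Y₁ → X₂ ⊆ Y₂ → (X₁ ⊠ X₂) ⊆ (Y₁ ⊠ Y₂)
⊠-mono {X₁ = X₁} X₁⊆Y₁ X₂⊆Y₂ (a , b) t =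
  from T-∧ (X₁⊆Y₁ a (proj₁ (to (T-∧ {X₁ a}) t)) , X₂⊆Y₂ b (proj₂ (to (T-∧ {X₁ a}) t)))

card-∪ : (L : List E) (X Y : Subset E) → card L (X ∪ Y) ≤ card L X + card L Y
card-∪ [] X Y = z≤n
card-∪ (e ∷ L) X Y with X e | Y e | card-∪ L X Y
... | true  | true  | ih = s≤s (≤-trans ih (+-monoʳ-≤ (card L X) (n≤1+n (card L Y))))
... | true  | false | ih = s≤s ih
... | false | true  | ih = ≤-trans (s≤s ih) (≤-reflexive (sym (+-suc (card L X) (card L Y))))
... | false | false | ih = ih

card-disjoint : (L : List E) → All (λ e → ¬ T (X e)) L → card L X ≡ 0
card-disjoint [] [] = refl
card-disjoint {X = X} (e ∷ L) (e∉X ∷ L∉X) with X e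
... | true  = ⊥-elim (e∉X _)
... | false = card-disjoint L L∉X

sumOver-cong : ∀ {n} (B : Subset (Fin n)) {f g : Fin n → ℕ} →
  (∀ i → f i ≡ g i) → sumOver B f ≡ sumOver B g
sumOver-cong {n} B f≗g = cong sum (map-cong (λ i → cong (λ v → if B i then v else 0) (f≗g i)) (allFin n))

sumOver-const : ∀ {n} (B : Subset (Fin n)) {f : Fin n → ℕ} {c : ℕ} →
  (∀ i → T (B i) → f i ≡ c) → sumOver B f ≡ c * card (allFin n) B
sumOver-const {n} B {f} {c} f≡c = go (allFin n)
  where
  go : ∀ L → sum (map (λ i → if B i then f i else 0) L) ≡ c * card L B
  go [] = sym (*-zeroʳ c)
  go (i ∷ L) with B i | f≡c i
  ... | true  | fi≡c = trans (cong₂ _+_ (fi≡c _) (go L)) (sym (*-suc c (card L B)))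
  ... | false | _    = go L

module Singletons {E : Set} (_≟_ : DecidableEquality E) where

  ⁅_⁆ : E → Subset E
  ⁅ x ⁆ y = ⌊ x ≟ y ⌋

  ⁅⁆-sound : ∀ {x y} → T (⁅ x ⁆ y) → x ≡ y
  ⁅⁆-sound {x} {y} = toWitness {a? = x ≟ y}

  ⁅⁆-refl : ∀ x → T (⁅ x ⁆ x)
  ⁅⁆-refl x = fromWitness {a? = x ≟ x} refl

  ∩⁅⁆-member : ∀ {X x} y → T ((X ∩ ⁅ x ⁆) y) → T (X x)
  ∩⁅⁆-member {X} {x} y t =
    subst (T ∘ X) (sym (⁅⁆-sound (∩-lowerʳ {X = X} {Y = ⁅ x ⁆} y t))) (∩-lowerˡ {X = X} {Y = ⁅ x ⁆} y t)

  fromList : List E → Subset E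
  fromList []      = λ _ → false
  fromList (x ∷ L) = fromList L ∪ ⁅ x ⁆

  fromList-complete : ∀ {x L} → x ∈ L → T (fromList L x)
  fromList-complete {x} {_ ∷ L} (here refl) = ∪-upperʳ {Y = ⁅ x ⁆} {X = fromList L} x (⁅⁆-refl x)
  fromList-complete {x} {y ∷ L} (there x∈L) = ∪-upperˡ {X = fromList L} {Y = ⁅ y ⁆} x (fromList-complete x∈L)

  card-⁅⁆ : ∀ {L} → Unique L → ∀ x → card L ⁅ x ⁆ ≤ 1
  card-⁅⁆ [] x = z≤n
  card-⁅⁆ {y ∷ L} (y∉L ∷ uniq) x with x ≟ y
  ... | yes refl = ≤-reflexive (cong suc (card-disjoint L (All.map (λ x≢z → x≢z ∘ ⁅⁆-sound) y∉L)))
  ... | no  _    = card-⁅⁆ uniq x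

module MatroidRank {E : Set} {U : List E} (M : Matroid E U)
  (_≟_ : DecidableEquality E) (∈U : ∀ x → x ∈ U) where

  open Singletons _≟_

  r-≗ : (∀ e → X e ≡ Y e) → r M X ≡ r M Y
  r-≗ X≗Y = ≤-antisym (r-mono M _ _ (≗⇒⊆ X≗Y)) (r-mono M _ _ (≗⇒⊆ (sym ∘ X≗Y)))

  -- A spans D when D lies in the closure of A.
  Spans : Subset E → Subset E → Set
  Spans A D = r M (A ∪ D) ≤ r M A

  spans-⊆ : W ⊆ Y → Spans X Y → Spans X W
  spans-⊆ {X = X} W⊆Y = ≤-trans (r-mono M _ _ (∪-monoʳ {X = X} W⊆Y))

  spans-self : Y ⊆ X → Spans X Y
  spans-self Y⊆X = r-mono M _ _ (∪-least ⊆-refl Y⊆X)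

  spans-superset : X ⊆ Y → r M Y ≤ r M X → Spans X Y
  spans-superset X⊆Y = ≤-trans (r-mono M _ _ (∪-least X⊆Y ⊆-refl))

  spans-mono : X ⊆ Z → Spans X Y → Spans Z Y
  spans-mono {X = X} {Z = Z} {Y = Y} X⊆Z X-spans-Y = +-cancelʳ-≤ (r M X) _ _ (begin
    r M (Z ∪ Y) + r M X                      ≤⟨ +-mono-≤ (r-mono M _ _ (∪-monoʳ {X = Z} (∪-upperʳ {X = X})))
                                                         (r-mono M _ _ (∩-greatest X⊆Z ∪-upperˡ)) ⟩
    r M (Z ∪ (X ∪ Y)) + r M (Z ∩ (X ∪ Y))    ≤⟨ r-sub M Z (X ∪ Y) ⟩
    r M Z + r M (X ∪ Y)                      ≤⟨ +-monoʳ-≤ (r M Z) X-spans-Y ⟩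
    r M Z + r M X                            ∎)
    where open ≤-Reasoning

  spans-trans : Spans X Y → Spans (X ∪ Y) W → Spans X (Y ∪ W)
  spans-trans {X = X} {Y = Y} {W = W} X-spans-Y XY-spans-W = begin
    r M (X ∪ (Y ∪ W)) ≤⟨ r-mono M _ _ (≗⇒⊆ (λ e → sym (∨-assoc (X e) (Y e) (W e)))) ⟩
    r M ((X ∪ Y) ∪ W) ≤⟨ XY-spans-W ⟩
    r M (X ∪ Y)       ≤⟨ X-spans-Y ⟩
    r M X             ∎
    where open ≤-Reasoning

  r-spanned : X ⊆ Y → Y ⊆ (X ∪ W) → Spans X W → r M Y ≡ r M X
  r-spanned X⊆Y Y⊆X∪W X-spans-W = ≤-antisym (≤-trans (r-mono M _ _ Y⊆X∪W) X-spans-W) (r-mono M _ _ X⊆Y)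

  spans-pointwise : (∀ x → T (Y x) → Spans X ⁅ x ⁆) → Spans X Y
  spans-pointwise {Y = Y} {X = X} spans-each =
    spans-⊆ (∩-greatest ⊆-refl (λ x _ → fromList-complete (∈U x))) (spans-prefix U)
    where
    spans-one : ∀ x → Spans X (Y ∩ ⁅ x ⁆)
    spans-one x with T? (Y x)
    ... | yes x∈Y = spans-⊆ (∩-lowerʳ {X = Y}) (spans-each x x∈Y)
    ... | no  x∉Y = spans-self (λ y t → ⊥-elim (x∉Y (∩⁅⁆-member {X = Y} y t)))
    spans-prefix : ∀ L → Spans X (Y ∩ fromList L)
    spans-prefix []      = spans-self (λ y t → ⊥-elim (∩-lowerʳ {X = Y} y t))
    spans-prefix (x ∷ L) = spans-⊆ (≗⇒⊆ (λ y → ∧-distribˡ-∨ (Y y) (fromList L y) (⁅ x ⁆ y)))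
      (spans-trans (spans-prefix L) (spans-mono ∪-upperˡ (spans-one x)))

  loop-spanned : ∀ {x} → IsLoop M x → Spans X ⁅ x ⁆
  loop-spanned {X = X} {x = x} loop = begin
    r M (X ∪ ⁅ x ⁆)                       ≤⟨ m≤m+n _ _ ⟩
    r M (X ∪ ⁅ x ⁆) + r M (X ∩ ⁅ x ⁆)     ≤⟨ r-sub M X ⁅ x ⁆ ⟩
    r M X + r M ⁅ x ⁆                     ≡⟨ cong (r M X +_) (loop ⁅ x ⁆ (λ _ t → sym (⁅⁆-sound t)) (⁅⁆-refl x)) ⟩
    r M X + 0                             ≡⟨ +-identityʳ _ ⟩
    r M X                                 ∎
    where open ≤-Reasoning

  -- Maximality: if B ∪ {x} were independent it would lie in B; otherwise its rank is below |B| + 1.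
  basis-spans : ∀ {B} → IsBasis M B → Unique U → ∀ x → Spans B ⁅ x ⁆
  basis-spans {B} (B-indep , B-maximal) uniq x with r M (B ∪ ⁅ x ⁆) ≟ℕ card U (B ∪ ⁅ x ⁆)
  ... | yes B+x-indep = r-mono M _ _ (B-maximal (B ∪ ⁅ x ⁆) ∪-upperˡ B+x-indep)
  ... | no  B+x-dep   = s≤s⁻¹ (begin-strict
    r M (B ∪ ⁅ x ⁆)            <⟨ ≤∧≢⇒< (r-card M _) B+x-dep ⟩
    card U (B ∪ ⁅ x ⁆)         ≤⟨ card-∪ U B ⁅ x ⁆ ⟩
    card U B + card U ⁅ x ⁆    ≤⟨ +-monoʳ-≤ (card U B) (card-⁅⁆ uniq x) ⟩
    card U B + 1               ≡⟨ +-comm (card U B) 1 ⟩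
    suc (card U B)             ≡⟨ cong suc (sym B-indep) ⟩
    suc (r M B)                ∎)
    where open ≤-Reasoning

  r-full-basis : ∀ {B} → IsBasis M B → Unique U → r M full ≡ r M B
  r-full-basis B-basis uniq =
    r-spanned ⊆-full ∪-upperʳ (spans-pointwise (λ x _ → basis-spans B-basis uniq x))

module Coupling {n₁ n₂ : ℕ} (M₁ : FinM n₁) (M₂ : FinM n₂)
  (B₁ : Subset (Fin n₁)) (B₂ : Subset (Fin n₂))
  (B₁-basis : IsBasis M₁ B₁) (B₂-basis : IsBasis M₂ B₂) (M : ProdM n₁ n₂)
  (loops : ∀ a b → T (not (B₁ a) ∧ not (B₂ b)) → IsLoop M (a , b))
  (amalgam : IsAmalgam (restrict-r M ((full ⊠ B₂) ∪ (B₁ ⊠ full)))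
               (full ⊠ B₂) (N₁-rank M₁ B₂) (B₁ ⊠ full) (N₂-rank M₂ B₁)) where

  private
    module R  = MatroidRank M (≡-dec _≟_ _≟_) (λ (a , b) → ∈-cartesianProduct⁺ (∈-allFin a) (∈-allFin b))
    module R₁ = MatroidRank M₁ _≟_ ∈-allFin
    module R₂ = MatroidRank M₂ _≟_ ∈-allFin
    open ≡-Reasoning

  r₁-full : r M₁ full ≡ r M₁ B₁
  r₁-full = R₁.r-full-basis B₁-basis (allFin⁺ n₁)

  r₂-full : r M₂ full ≡ r M₂ B₂
  r₂-full = R₂.r-full-basis B₂-basis (allFin⁺ n₂)

  Loops : Subset (Fin n₁ × Fin n₂)
  Loops = (not ∘ B₁) ⊠ (not ∘ B₂)

  spans-Loops : ∀ A → R.Spans A Loops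
  spans-Loops A = R.spans-pointwise (λ (a , b) t → R.loop-spanned (loops a b t))

  r-⊠-full : ∀ X₁ → r M (X₁ ⊠ full) ≡ r M₁ X₁ * r M₂ full
  r-⊠-full X₁ = begin
    r M (X₁ ⊠ full)                 ≡⟨ R.r-spanned (⊠-mono ⊆-refl ⊆-full) cover
                                         (R.spans-trans P-spans-Q (spans-Loops _)) ⟩
    r M (X₁ ⊠ B₂)                   ≡⟨ proj₁ amalgam _ (⊠-mono ⊆-full ⊆-refl) ⟩
    N₁-rank M₁ B₂ (X₁ ⊠ B₂)         ≡⟨ sumOver-const B₂ (λ i → row (B₂ i)) ⟩
    r M₁ X₁ * card (allFin n₂) B₂   ≡⟨ cong (r M₁ X₁ *_) (sym (trans r₂-full (proj₁ B₂-basis))) ⟩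
    r M₁ X₁ * r M₂ full             ∎
    where
    Q C : Subset (Fin n₁ × Fin n₂)
    Q = (X₁ ∩ B₁) ⊠ full
    C = (X₁ ∩ B₁) ⊠ B₂

    row : ∀ c → T c → r M₁ (λ x → X₁ x ∧ c) ≡ r M₁ X₁
    row true _ = R₁.r-≗ (∧-identityʳ ∘ X₁)

    column : ∀ c → r M₂ (λ y → c ∧ true) ≡ r M₂ (λ y → c ∧ B₂ y)
    column true  = r₂-full
    column false = refl

    rQ≡rC : r M Q ≡ r M C
    rQ≡rC = begin
      r M Q             ≡⟨ proj₂ amalgam Q (⊠-mono (∩-lowerʳ {X = X₁}) ⊆-refl) ⟩
      N₂-rank M₂ B₁ Q   ≡⟨ sumOver-cong B₁ (λ a → column (X₁ a ∧ B₁ a)) ⟩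
      N₂-rank M₂ B₁ C   ≡⟨ sym (proj₂ amalgam C (⊠-mono (∩-lowerʳ {X = X₁}) ⊆-full)) ⟩
      r M C             ∎

    P-spans-Q : R.Spans (X₁ ⊠ B₂) Q
    P-spans-Q = R.spans-mono (⊠-mono (∩-lowerˡ {X = X₁} {Y = B₁}) (⊆-refl {X = B₂}))
      (R.spans-superset (⊠-mono ⊆-refl ⊆-full) (≤-reflexive rQ≡rC))

    cover : (X₁ ⊠ full) ⊆ ((X₁ ⊠ B₂) ∪ (Q ∪ Loops))
    cover (a , b) t with X₁ a | B₁ a | B₂ b
    ... | true  | _     | true  = _
    ... | true  | true  | false = _
    ... | true  | false | false = _
    ... | false | _     | _     = ⊥-elim t

  r-full-⊠ : ∀ X₂ → r M (full ⊠ X₂) ≡ r M₁ full * r M₂ X₂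
  r-full-⊠ X₂ = begin
    r M (full ⊠ X₂)                 ≡⟨ R.r-spanned (⊠-mono (⊆-full {X = B₁}) ⊆-refl) cover
                                         (R.spans-trans P-spans-Q (spans-Loops _)) ⟩
    r M (B₁ ⊠ X₂)                   ≡⟨ proj₂ amalgam _ (⊠-mono ⊆-refl ⊆-full) ⟩
    N₂-rank M₂ B₁ (B₁ ⊠ X₂)         ≡⟨ sumOver-const B₁ (λ i → column (B₁ i)) ⟩
    r M₂ X₂ * card (allFin n₁) B₁   ≡⟨ *-comm (r M₂ X₂) _ ⟩
    card (allFin n₁) B₁ * r M₂ X₂   ≡⟨ cong (_* r M₂ X₂) (sym (trans r₁-full (proj₁ B₁-basis))) ⟩
    r M₁ full * r M₂ X₂             ∎
    where
    Q C : Subset (Fin n₁ × Fin n₂)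
    Q = full ⊠ (X₂ ∩ B₂)
    C = B₁ ⊠ (X₂ ∩ B₂)

    column : ∀ c → T c → r M₂ (λ y → c ∧ X₂ y) ≡ r M₂ X₂
    column true _ = refl

    row : ∀ c → r M₁ (λ x → true ∧ c) ≡ r M₁ (λ x → B₁ x ∧ c)
    row true  = trans r₁-full (R₁.r-≗ (sym ∘ ∧-identityʳ ∘ B₁))
    row false = R₁.r-≗ (sym ∘ ∧-zeroʳ ∘ B₁)

    rQ≡rC : r M Q ≡ r M C
    rQ≡rC = begin
      r M Q             ≡⟨ proj₁ amalgam Q (⊠-mono (⊆-full {X = full}) (∩-lowerʳ {X = X₂})) ⟩
      N₁-rank M₁ B₂ Q   ≡⟨ sumOver-cong B₂ (λ b → row (X₂ b ∧ B₂ b)) ⟩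
      N₁-rank M₁ B₂ C   ≡⟨ sym (proj₁ amalgam C (⊠-mono (⊆-full {X = B₁}) (∩-lowerʳ {X = X₂}))) ⟩
      r M C             ∎

    P-spans-Q : R.Spans (B₁ ⊠ X₂) Q
    P-spans-Q = R.spans-mono (⊠-mono (⊆-refl {X = B₁}) (∩-lowerˡ {Y = B₂}))
      (R.spans-superset (⊠-mono (⊆-full {X = B₁}) ⊆-refl) (≤-reflexive rQ≡rC))

    cover : (full ⊠ X₂) ⊆ ((B₁ ⊠ X₂) ∪ (Q ∪ Loops))
    cover (a , b) t with X₂ b | B₁ a | B₂ b
    ... | true  | true  | _     = _
    ... | true  | false | true  = _
    ... | true  | false | false = _
    ... | false | _     | _     = ⊥-elim t

theorem3p7 : (n₁ n₂ : ℕ) (M₁ : FinM n₁) (M₂ : FinM n₂)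
    (B₁ : Subset (Fin n₁)) (B₂ : Subset (Fin n₂)) →
    IsBasis M₁ B₁ → IsBasis M₂ B₂ →
    (M : ProdM n₁ n₂) →
    (∀ (a : Fin n₁) (b : Fin n₂) → T (not (B₁ a) ∧ not (B₂ b)) → IsLoop M (a , b)) →
    IsAmalgam (restrict-r M ((full ⊠ B₂) ∪ (B₁ ⊠ full)))
      (full ⊠ B₂) (N₁-rank M₁ B₂)
      (B₁ ⊠ full) (N₂-rank M₂ B₁) →
    IsCoupling M M₁ M₂
theorem3p7 n₁ n₂ M₁ M₂ B₁ B₂ B₁-basis B₂-basis M loops amalgam = r-⊠-full , r-full-⊠
  where open Coupling M₁ M₂ B₁ B₂ B₁-basis B₂-basis M loops amalgam
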